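{- For every positive integer $d$, the linear map $A_d:\mathcal{P}^d\to\mathcal{P}^{d+1}$ is injective.
   Context: $\mathcal{P}^d$ is the real vector space of polynomials of degree at most $d$. $G_n$ is the ladder graph with vertices $(j,0),(j,1)$, $0\le j\le n$, horizontal edges $(j,a)(j+1,a)$ and vertical edges $(j,0)(j,1)$; $\mathcal{C}(G_n)$ is the cubical complex of its tilings (partitions of the vertex set into edges and vertex sets of unit squares), a tiling with exactly $k$ squares being a $k$-dimensional face; $F_n(x)=\sum_kf_kx^k$ with $f_k$ the number of $k$-dimensional faces, and $P_n(x)=F_n(x-1)$ (equivalently, the coefficient of $x^k$ in $P_n$ is $\binom{n+1-k}{k}$). The linear maps $A_d:\mathcal{P}^d\to\mathcal{P}^{d+1}$ are defined recursively by $A_d(x^k)=xA_{d-1}(x^{k-1})$ for $k>0$, $A_0(1)=1+2x$, and $A_d(1)=P_{2d+1}-A_d(P_{2d-1}-1)$ for $d\ge1$.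
   Formalization: The polynomials in $\mathcal{P}^d$ have rational coefficients instead of real ones. -}

module Defs where

open import Data.Nat using (ℕ; zero; suc; _∸_) renaming (_+_ to _+ℕ_; _*_ to _*ℕ_)
open import Data.Nat.Combinatorics using (_C_)
open import Data.Integer using (+_)
open import Data.Rational using (ℚ; _+_; _*_; _-_; _/_; 0ℚ; 1ℚ)
open import Data.Fin using (Fin; toℕ)
open import Data.Vec using (Vec; []; _∷_; tabulate; map; zipWith; tail)

-- A polynomial in 𝒫^d (degree ≤ d) is represented by its coefficient vector
-- (c₀, c₁, …, c_d) : Vec ℚ (suc d), the i-th entry being the coefficient of x^i.
Poly : ℕ → Set
Poly d = Vec ℚ (suc d)

ℕtoℚ : ℕ → ℚ
ℕtoℚ n = (+ n) / 1

_⊕_ : ∀ {m} → Vec ℚ m → Vec ℚ m → Vec ℚ m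
_⊕_ = zipWith _+_

_⊖_ : ∀ {m} → Vec ℚ m → Vec ℚ m → Vec ℚ m
_⊖_ = zipWith _-_

_·_ : ∀ {m} → ℚ → Vec ℚ m → Vec ℚ m
c · v = map (c *_) v

mulX : ∀ {m} → Vec ℚ m → Vec ℚ (suc m)
mulX v = 0ℚ ∷ v

-- P_n(x) = F_n(x-1): the coefficient of x^k is binom(n+1-k, k).
-- PolyP n m gives the first m coefficients (x^0, …, x^{m-1}) of P_n.
PolyP : ℕ → (m : ℕ) → Vec ℚ m
PolyP n m = tabulate (λ k → ℕtoℚ (((n +ℕ 1) ∸ toℕ k) C toℕ k))

-- The linear maps A_d : 𝒫^d → 𝒫^{d+1}, i.e. the linear extension of
--   A_0(1) = 1 + 2x,
--   A_d(x^k) = x · A_{d-1}(x^{k-1})                  (k > 0),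
--   A_d(1)   = P_{2d+1} - A_d(P_{2d-1} - 1)           (d ≥ 1).
-- Writing p = c + x·q with q ∈ 𝒫^{d-1}, linearity gives
--   A_d(p) = c·A_d(1) + x·A_{d-1}(q).
-- Since P_{2d-1} - 1 has zero constant term and degree ≤ d, it equals x·q₀ with
-- q₀ = tail of the coefficient vector of P_{2d-1}, so A_d(P_{2d-1}-1) = x·A_{d-1}(q₀).
-- P_{2d+1} has degree ≤ d+1, so its d+2 coefficients are all of it.
A : (d : ℕ) → Poly d → Poly (suc d)
A zero (c ∷ []) = c · (1ℚ ∷ ℕtoℚ 2 ∷ [])
A (suc d) (c ∷ q) =
  (c · (PolyP (2 *ℕ suc d +ℕ 1) (suc (suc (suc d)))
         ⊖ mulX (A d (tail (PolyP (2 *ℕ suc d ∸ 1) (suc (suc d)))))))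
  ⊕ mulX (A d q)

{-# OPTIONS --safe #-}
-- Writing p = c + x·q, linearity gives A_d(p) = c·A_d(1) + x·A_{d-1}(q), and the
-- constant term of A_d(1) is that of P_{2d+1}, namely 1 (for d = 0 it is that of 1 + 2x).
-- So A_d preserves the constant term c; once c is known, c·A_d(1) can be subtracted
-- and the higher coefficients of A_d(p) determine A_{d-1}(q), hence q by induction.
module Submission where

open import Defs
open import Data.Nat using (ℕ; _≤_; zero; suc)
open import Data.Rational.Properties using (+-0-group; +-identityʳ; *-identityʳ)
open import Data.Vec using ([]; _∷_; head; zipWith)
open import Data.Vec.Properties using (∷-injectiveˡ; ∷-injectiveʳ)
open import Algebra.Definitions using (LeftCancellative)
open import Algebra.Properties.Group +-0-group using (∙-cancelˡ)
open import Function.Definitions using (Injective)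
open import Relation.Binary.PropositionalEquality using (_≡_; refl; cong; cong₂; sym; trans)

zipWith-cancelˡ : ∀ {a} {X : Set a} {f : X → X → X} {n} →
                  LeftCancellative _≡_ f → LeftCancellative _≡_ (zipWith {n = n} f)
zipWith-cancelˡ cancel []       []       []       _  = refl
zipWith-cancelˡ cancel (x ∷ xs) (y ∷ ys) (z ∷ zs) eq =
  cong₂ _∷_ (cancel x y z (∷-injectiveˡ eq)) (zipWith-cancelˡ cancel xs ys zs (∷-injectiveʳ eq))

⊕-cancelˡ : ∀ {m} → LeftCancellative _≡_ (_⊕_ {m})
⊕-cancelˡ = zipWith-cancelˡ ∙-cancelˡ

head-A : ∀ d (p : Poly d) → head (A d p) ≡ head p
head-A zero    (c ∷ []) = *-identityʳ c
head-A (suc d) (c ∷ _)  = trans (+-identityʳ _) (*-identityʳ c)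

A-≡⇒head-≡ : ∀ d (p p′ : Poly d) → A d p ≡ A d p′ → head p ≡ head p′
A-≡⇒head-≡ d p p′ eq = trans (sym (head-A d p)) (trans (cong head eq) (head-A d p′))

A-injective : ∀ d → Injective _≡_ _≡_ (A d)
A-injective zero    {c ∷ []} {c′ ∷ []} eq = cong (_∷ []) (A-≡⇒head-≡ zero (c ∷ []) (c′ ∷ []) eq)
A-injective (suc d) {c ∷ q}  {c′ ∷ q′} eq with A-≡⇒head-≡ (suc d) (c ∷ q) (c′ ∷ q′) eq
... | refl = cong (c ∷_) (A-injective d (⊕-cancelˡ _ _ _ (∷-injectiveʳ eq)))

corollary4p7 : (d : ℕ) → 1 ≤ d → Injective _≡_ _≡_ (A d)
corollary4p7 d _ = A-injective d
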